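{- For every formula $F$ of intuitionistic (minimal) propositional logic built from atomic formulas and $\top$ using $\wedge,\vee,\to$, either $[\![F]\!]\ge 2$ or $F\rightsquigarrow^*\top$.
   Context: The interpretation $[\![-]\!]$ maps formulas to natural numbers: $[\![P]\!]=2$ for atomic $P$, $[\![\top]\!]=1$, $[\![F\vee G]\!]=[\![F]\!]+[\![G]\!]$, $[\![F\wedge G]\!]=[\![F]\!]\cdot[\![G]\!]$, $[\![G\to F]\!]=[\![F]\!]^{[\![G]\!]}$. The simplification relation $\rightsquigarrow$ is given by the rules $\top\wedge F\rightsquigarrow F$, $F\wedge\top\rightsquigarrow F$, $\top\to F\rightsquigarrow F$, $F\to\top\rightsquigarrow\top$, applicable to any subformula; $\rightsquigarrow^*$ is its reflexive-transitive closure. -}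

module Defs where

open import Data.Nat using (ℕ; _+_; _*_; _^_)
open import Relation.Binary.Construct.Closure.ReflexiveTransitive using (Star)

data Formula : Set where
  atom : ℕ → Formula
  ⊤'   : Formula
  _∧'_ : Formula → Formula → Formula
  _∨'_ : Formula → Formula → Formula
  _⇒_  : Formula → Formula → Formula

infixr 6 _∧'_
infixr 5 _∨'_
infixr 4 _⇒_

⟦_⟧ : Formula → ℕ
⟦ atom _ ⟧ = 2
⟦ ⊤' ⟧ = 1
⟦ F ∨' G ⟧ = ⟦ F ⟧ + ⟦ G ⟧
⟦ F ∧' G ⟧ = ⟦ F ⟧ * ⟦ G ⟧
⟦ G ⇒ F ⟧ = ⟦ F ⟧ ^ ⟦ G ⟧

data _↝_ : Formula → Formula → Set where
  ⊤∧   : ∀ {F} → (⊤' ∧' F) ↝ F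
  ∧⊤   : ∀ {F} → (F ∧' ⊤') ↝ F
  ⊤⇒   : ∀ {F} → (⊤' ⇒ F) ↝ F
  ⇒⊤   : ∀ {F} → (F ⇒ ⊤') ↝ ⊤'
  ∧ˡ   : ∀ {F F' G} → F ↝ F' → (F ∧' G) ↝ (F' ∧' G)
  ∧ʳ   : ∀ {F G G'} → G ↝ G' → (F ∧' G) ↝ (F ∧' G')
  ∨ˡ   : ∀ {F F' G} → F ↝ F' → (F ∨' G) ↝ (F' ∨' G)
  ∨ʳ   : ∀ {F G G'} → G ↝ G' → (F ∨' G) ↝ (F ∨' G')
  ⇒ˡ   : ∀ {F F' G} → F ↝ F' → (F ⇒ G) ↝ (F' ⇒ G)
  ⇒ʳ   : ∀ {F G G'} → G ↝ G' → (F ⇒ G) ↝ (F ⇒ G')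

infix 3 _↝_ _↝*_

_↝*_ : Formula → Formula → Set
_↝*_ = Star _↝_

module Submission where

-- The proof is a structural induction, driven by two general facts:
--   * every formula has a positive value (`value-positive`), so in a product
--     or a power one factor of size ≥ 2 already makes the whole value ≥ 2,
--     and a disjunction always has value ≥ 1 + 1;
--   * simplification is a congruence: a reduction sequence inside a
--     subformula lifts to the whole formula (`gmap` of the congruence rule).  For F ∧ G, if one conjunct has
-- value ≥ 2 so does the product; otherwise both reduce to ⊤ and ⊤ ∧ ⊤ ↝ ⊤.
-- For G → F, if F has value ≥ 2 then so does F ^ ⟦G⟧ (as ⟦G⟧ ≥ 1);
-- otherwise F ↝* ⊤ and G → ⊤ ↝ ⊤, whatever G is.

open import Defs
open import Data.Nat using (zero; suc; _≤_; _≥_; s≤s; z≤n; _*_; _^_)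
open import Data.Nat.Properties using (*-mono-≤; +-mono-≤; ≤-trans)
open import Data.Sum using (_⊎_; inj₁; inj₂)
open import Relation.Binary.Construct.Closure.ReflexiveTransitive
  using (ε; _◅_; _◅◅_; gmap)

^-positive : ∀ m k → 1 ≤ m → 1 ≤ m ^ k
^-positive m zero    _   = s≤s z≤n
^-positive m (suc k) 1≤m = *-mono-≤ 1≤m (^-positive m k 1≤m)

^-atLeast2 : ∀ m k → 2 ≤ m → 1 ≤ k → 2 ≤ m ^ k
^-atLeast2 m (suc k) 2≤m _ =
  *-mono-≤ {2} {m} {1} 2≤m (^-positive m k (≤-trans (s≤s z≤n) 2≤m))

value-positive : ∀ F → 1 ≤ ⟦ F ⟧
value-positive (atom _) = s≤s z≤n
value-positive ⊤'       = s≤s z≤n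
value-positive (F ∧' G) = *-mono-≤ (value-positive F) (value-positive G)
value-positive (F ∨' G) = +-mono-≤ {1} {⟦ F ⟧} {0} (value-positive F) z≤n
value-positive (G ⇒ F)  = ^-positive ⟦ F ⟧ ⟦ G ⟧ (value-positive F)

∧-↝*⊤ : ∀ {F G} → F ↝* ⊤' → G ↝* ⊤' → F ∧' G ↝* ⊤'
∧-↝*⊤ {G = G} F↝⊤ G↝⊤ =
  gmap (λ X → X ∧' G) ∧ˡ F↝⊤ ◅◅
  gmap (λ X → ⊤' ∧' X) ∧ʳ G↝⊤ ◅◅
  ⊤∧ ◅ ε

⇒-↝*⊤ : ∀ {G F} → F ↝* ⊤' → G ⇒ F ↝* ⊤'
⇒-↝*⊤ {G} F↝⊤ = gmap (λ X → G ⇒ X) ⇒ʳ F↝⊤ ◅◅ ⇒⊤ ◅ ε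

lemma8 : (F : Formula) → (⟦ F ⟧ ≥ 2) ⊎ (F ↝* ⊤')
lemma8 (atom _) = inj₁ (s≤s (s≤s z≤n))
lemma8 ⊤'       = inj₂ ε
lemma8 (F ∨' G) = inj₁ (+-mono-≤ (value-positive F) (value-positive G))
lemma8 (F ∧' G) with lemma8 F | lemma8 G
... | inj₁ F≥2 | _        = inj₁ (*-mono-≤ {2} {⟦ F ⟧} {1} F≥2 (value-positive G))
... | inj₂ _   | inj₁ G≥2 = inj₁ (*-mono-≤ {1} {⟦ F ⟧} {2} (value-positive F) G≥2)
... | inj₂ F↝⊤ | inj₂ G↝⊤ = inj₂ (∧-↝*⊤ F↝⊤ G↝⊤)
lemma8 (G ⇒ F) with lemma8 F
... | inj₁ F≥2 = inj₁ (^-atLeast2 ⟦ F ⟧ ⟦ G ⟧ F≥2 (value-positive G))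
... | inj₂ F↝⊤ = inj₂ (⇒-↝*⊤ F↝⊤)
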